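{- Let $T$ be a simple filter of a residuated lattice $L$. Then one of the following holds: (1) there exists $x\in B(L)$ such that $T=[x)$, and in this case $[x^*)$ is the only maximal filter of $L$ not containing $T$; or (2) for all $x\in T$ we have $[x^*)=L$, and in this case $T$ is contained in every maximal filter of $L$, i.e. $T\subseteq \mathrm{Rad}(L)$.
   Context: A residuated lattice is an algebra $(L,\wedge,\vee,\odot,\rightarrow,0,1)$ such that $(L,\wedge,\vee,0,1)$ is a bounded lattice, $(L,\odot,1)$ is a commutative monoid, and $x\odot z\le y$ iff $z\le x\rightarrow y$. Write $x^*:=x\rightarrow 0$. $B(L)$ is the set of complemented elements of $L$. A filter is a nonempty subset closed under $\odot$ and upward closed; $[x)$ is the filter generated by $x$. A maximal filter is a proper filter not strictly contained in another proper filter; $\mathrm{Rad}(L)$ is the intersection of all maximal filters of $L$. A filter $T$ is simple if $T\neq\{1\}$ and the only filters contained in $T$ are $\{1\}$ and $T$. -}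

module Defs where

open import Level using (Level; suc; _⊔_)
open import Data.Nat using (ℕ; zero) renaming (suc to sucℕ)
open import Data.Product using (Σ; _×_; ∃)
open import Data.Sum using (_⊎_)
open import Relation.Nullary using (¬_)
open import Relation.Binary.PropositionalEquality using (_≡_)
open import Relation.Unary using (Pred; _⊆_; _≐_; ｛_｝)

record ResiduatedLattice (ℓ : Level) : Set (suc ℓ) where
  infixr 5 _⇒_
  infixl 7 _⊙_
  infixl 6 _∧_
  infixl 5 _∨_
  infix 4 _≤_
  field
    Carrier : Set ℓ
    _∧_ _∨_ _⊙_ _⇒_ : Carrier → Carrier → Carrier
    0# 1# : Carrier
    ∧-assoc : ∀ x y z → (x ∧ y) ∧ z ≡ x ∧ (y ∧ z)
    ∨-assoc : ∀ x y z → (x ∨ y) ∨ z ≡ x ∨ (y ∨ z)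
    ∧-comm : ∀ x y → x ∧ y ≡ y ∧ x
    ∨-comm : ∀ x y → x ∨ y ≡ y ∨ x
    ∧-absorbs-∨ : ∀ x y → x ∧ (x ∨ y) ≡ x
    ∨-absorbs-∧ : ∀ x y → x ∨ (x ∧ y) ≡ x
    0-least : ∀ x → 0# ∧ x ≡ 0#
    1-greatest : ∀ x → x ∧ 1# ≡ x
    ⊙-assoc : ∀ x y z → (x ⊙ y) ⊙ z ≡ x ⊙ (y ⊙ z)
    ⊙-comm : ∀ x y → x ⊙ y ≡ y ⊙ x
    ⊙-identityʳ : ∀ x → x ⊙ 1# ≡ x

  _≤_ : Carrier → Carrier → Set ℓ
  x ≤ y = x ∧ y ≡ x

  field
    residuation→ : ∀ x y z → x ⊙ z ≤ y → z ≤ x ⇒ y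
    residuation← : ∀ x y z → z ≤ x ⇒ y → x ⊙ z ≤ y

module _ {ℓ : Level} (L : ResiduatedLattice ℓ) where
  open ResiduatedLattice L

  _* : Carrier → Carrier
  x * = x ⇒ 0#

  pow : Carrier → ℕ → Carrier
  pow x zero = 1#
  pow x (sucℕ n) = x ⊙ pow x n

  B : Pred Carrier ℓ
  B x = Σ Carrier (λ y → (x ∨ y ≡ 1#) × (x ∧ y ≡ 0#))

  record IsFilter (F : Pred Carrier ℓ) : Set ℓ where
    field
      nonempty : ∃ F
      ⊙-closed : ∀ {x y} → F x → F y → F (x ⊙ y)
      up-closed : ∀ {x y} → F x → x ≤ y → F y

  Proper : Pred Carrier ℓ → Set ℓ
  Proper F = ¬ (∀ y → F y)

  -- [x) = gen x: the filter generated by x, { y | x^n ≤ y for some n ≥ 1 }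
  gen : Carrier → Pred Carrier ℓ
  gen x = λ y → Σ ℕ (λ n → pow x (sucℕ n) ≤ y)

  IsMaximal : Pred Carrier ℓ → Set (suc ℓ)
  IsMaximal M = IsFilter M × Proper M
    × (∀ (G : Pred Carrier ℓ) → IsFilter G → Proper G → M ⊆ G → G ⊆ M)

  Rad : Pred Carrier (suc ℓ)
  Rad y = ∀ (M : Pred Carrier ℓ) → IsMaximal M → M y

  IsSimple : Pred Carrier ℓ → Set (suc ℓ)
  IsSimple T = IsFilter T × ¬ (T ≐ ｛ 1# ｝)
    × (∀ (G : Pred Carrier ℓ) → IsFilter G → G ⊆ T → (G ≐ ｛ 1# ｝) ⊎ (G ≐ T))

{-# OPTIONS --safe #-}
-- Split on whether [x*) is a proper filter for some x ∈ T.
--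
-- If so, then x ∉ [x*), so the filter T ∩ [x*) ⊆ T is not T and by simplicity is {1};
-- as x ∨ x* lies in it, x ∨ x* = 1: x is complemented, idempotent, and T = [x).
-- For any proper filter G ⊇ [x*) the same argument gives x ∨ y = 1, i.e. x* ≤ y, for every
-- y ∈ G, so [x*) is maximal. A maximal M ∌ x contains some (xⁿ)* = x*, because the filter
-- generated by M ∪ {x} is improper; hence M = [x*).
--
-- Otherwise [x*) = L for every x ∈ T, and a maximal filter missing some x ∈ T would contain
-- (xⁿ)* for some n, hence all of [(xⁿ)*) = L.
module Submission where

open import Defs
open import Level using (Level; suc; lift; lower)
open import Algebra.Bundles using (CommutativeMonoid)
open import Algebra.Structures.Biased using (isCommutativeMonoidʳ)
import Algebra.Properties.CommutativeSemigroup as CommutativeSemigroupProperties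
open import Axiom.ExcludedMiddle using (ExcludedMiddle)
open import Data.Empty using (⊥-elim)
open import Data.Nat using (zero; _+_) renaming (suc to sucℕ)
open import Data.Product using (Σ; ∃; ∃₂; _×_; _,_; proj₁; proj₂)
open import Data.Sum using (_⊎_; inj₁; inj₂)
open import Data.Unit using (tt)
open import Function using (_∘_)
open import Relation.Nullary using (¬_; Dec; yes; no)
open import Relation.Nullary.Decidable using (map′; decidable-stable)
open import Relation.Unary using (Pred; U; _⊆_; _≐_; _∩_)
open import Relation.Binary.PropositionalEquality
  using (_≡_; refl; sym; trans; cong; cong₂; subst; subst₂; isEquivalence; module ≡-Reasoning)

decide : ∀ {ℓ} → ExcludedMiddle (suc ℓ) → (P : Set ℓ) → Dec P
decide em P = map′ lower lift em

module _ {ℓ : Level} (L : ResiduatedLattice ℓ) where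
  open ResiduatedLattice L

  ∧-idem : ∀ x → x ∧ x ≡ x
  ∧-idem x = trans (cong (x ∧_) (sym (∨-absorbs-∧ x x))) (∧-absorbs-∨ x (x ∧ x))

  ≤-refl : ∀ {x} → x ≤ x
  ≤-refl = ∧-idem _

  ≤-reflexive : ∀ {x y} → x ≡ y → x ≤ y
  ≤-reflexive refl = ≤-refl

  ≤-trans : ∀ {x y z} → x ≤ y → y ≤ z → x ≤ z
  ≤-trans {x} {y} {z} x≤y y≤z = begin
    x ∧ z        ≡⟨ cong (_∧ z) (sym x≤y) ⟩
    x ∧ y ∧ z    ≡⟨ ∧-assoc x y z ⟩
    x ∧ (y ∧ z)  ≡⟨ cong (x ∧_) y≤z ⟩
    x ∧ y        ≡⟨ x≤y ⟩
    x            ∎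
    where open ≡-Reasoning

  ≤-antisym : ∀ {x y} → x ≤ y → y ≤ x → x ≡ y
  ≤-antisym {x} {y} x≤y y≤x = trans (sym x≤y) (trans (∧-comm x y) y≤x)

  x∧y≤y : ∀ x y → x ∧ y ≤ y
  x∧y≤y x y = trans (∧-assoc x y y) (cong (x ∧_) (∧-idem y))

  x∧y≤x : ∀ x y → x ∧ y ≤ x
  x∧y≤x x y = subst (_≤ x) (∧-comm y x) (x∧y≤y y x)

  x≤x∨y : ∀ x y → x ≤ x ∨ y
  x≤x∨y = ∧-absorbs-∨

  y≤x∨y : ∀ x y → y ≤ x ∨ y
  y≤x∨y x y = subst (y ≤_) (∨-comm y x) (x≤x∨y y x)

  ≤⇒∨≡ : ∀ {x y} → x ≤ y → x ∨ y ≡ y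
  ≤⇒∨≡ {x} {y} x≤y = begin
    x ∨ y        ≡⟨ cong (_∨ y) (sym x≤y) ⟩
    x ∧ y ∨ y    ≡⟨ ∨-comm (x ∧ y) y ⟩
    y ∨ x ∧ y    ≡⟨ cong (y ∨_) (∧-comm x y) ⟩
    y ∨ y ∧ x    ≡⟨ ∨-absorbs-∧ y x ⟩
    y            ∎
    where open ≡-Reasoning

  ∨-least : ∀ {x y z} → x ≤ z → y ≤ z → x ∨ y ≤ z
  ∨-least {x} {y} {z} x≤z y≤z = begin
    (x ∨ y) ∧ z            ≡⟨ cong ((x ∨ y) ∧_) (sym x∨y∨z≡z) ⟩
    (x ∨ y) ∧ (x ∨ y ∨ z)  ≡⟨ ∧-absorbs-∨ (x ∨ y) z ⟩
    x ∨ y                  ∎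
    where
    open ≡-Reasoning
    x∨y∨z≡z : x ∨ y ∨ z ≡ z
    x∨y∨z≡z = trans (∨-assoc x y z) (trans (cong (x ∨_) (≤⇒∨≡ y≤z)) (≤⇒∨≡ x≤z))

  ⊙-commutativeMonoid : CommutativeMonoid ℓ ℓ
  ⊙-commutativeMonoid = record
    { isCommutativeMonoid = isCommutativeMonoidʳ record
      { isSemigroup = record
        { isMagma = record { isEquivalence = isEquivalence ; ∙-cong = cong₂ _⊙_ }
        ; assoc = ⊙-assoc
        }
      ; identityʳ = ⊙-identityʳ
      ; comm = ⊙-comm
      }
    }

  open CommutativeMonoid ⊙-commutativeMonoid using () renaming (identityˡ to ⊙-identityˡ)
  open CommutativeSemigroupProperties (CommutativeMonoid.commutativeSemigroup ⊙-commutativeMonoid)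
    using () renaming (interchange to ⊙-interchange)

  ⊙-monoʳ : ∀ {x y} z → x ≤ y → z ⊙ x ≤ z ⊙ y
  ⊙-monoʳ z x≤y = residuation← z _ _ (≤-trans x≤y (residuation→ z _ _ ≤-refl))

  ⊙-monoˡ : ∀ {x y} z → x ≤ y → x ⊙ z ≤ y ⊙ z
  ⊙-monoˡ z x≤y = subst₂ _≤_ (⊙-comm z _) (⊙-comm z _) (⊙-monoʳ z x≤y)

  ⊙-mono : ∀ {x y u v} → x ≤ y → u ≤ v → x ⊙ u ≤ y ⊙ v
  ⊙-mono x≤y u≤v = ≤-trans (⊙-monoˡ _ x≤y) (⊙-monoʳ _ u≤v)

  x⊙y≤x : ∀ x y → x ⊙ y ≤ x
  x⊙y≤x x y =
    residuation← x x y
      (≤-trans (1-greatest y) (residuation→ x x 1# (≤-reflexive (⊙-identityʳ x))))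

  x⊙y≤y : ∀ x y → x ⊙ y ≤ y
  x⊙y≤y x y = subst (_≤ y) (⊙-comm y x) (x⊙y≤x y x)

  x⊙x*≤0 : ∀ x → x ⊙ (x ⇒ 0#) ≤ 0#
  x⊙x*≤0 x = residuation← x 0# _ ≤-refl

  x*⊙x≤0 : ∀ x → (x ⇒ 0#) ⊙ x ≤ 0#
  x*⊙x≤0 x = subst (_≤ 0#) (⊙-comm x _) (x⊙x*≤0 x)

  1*≤0 : 1# ⇒ 0# ≤ 0#
  1*≤0 = subst (_≤ 0#) (⊙-identityˡ _) (x⊙x*≤0 1#)

  ≤-by-∨≡1 : ∀ {x y z u} → x ∨ y ≡ 1# → z ⊙ x ≤ u → z ⊙ y ≤ u → z ≤ u
  ≤-by-∨≡1 {x} {y} {z} {u} x∨y≡1 zx≤u zy≤u = subst (_≤ u) (⊙-identityʳ z)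
    (residuation← z u 1# (subst (_≤ z ⇒ u) x∨y≡1
      (∨-least (residuation→ z u x zx≤u) (residuation→ z u y zy≤u))))

  ∨≡1⇒*≤ : ∀ {x y} → x ∨ y ≡ 1# → x ⇒ 0# ≤ y
  ∨≡1⇒*≤ {x} {y} x∨y≡1 =
    ≤-by-∨≡1 x∨y≡1 (≤-trans (x*⊙x≤0 x) (0-least y)) (x⊙y≤y (x ⇒ 0#) y)

  ∨*≡1⇒∧*≡0 : ∀ {x} → x ∨ (x ⇒ 0#) ≡ 1# → x ∧ (x ⇒ 0#) ≡ 0#
  ∨*≡1⇒∧*≡0 {x} x∨x*≡1 = ≤-antisym
    (≤-by-∨≡1 x∨x*≡1
      (≤-trans (⊙-monoˡ x (x∧y≤y x (x ⇒ 0#))) (x*⊙x≤0 x))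
      (≤-trans (⊙-monoˡ (x ⇒ 0#) (x∧y≤x x (x ⇒ 0#))) (x⊙x*≤0 x)))
    (0-least _)

  ∨*≡1⇒⊙-idem : ∀ {x} → x ∨ (x ⇒ 0#) ≡ 1# → x ⊙ x ≡ x
  ∨*≡1⇒⊙-idem {x} x∨x*≡1 =
    ≤-antisym (x⊙y≤x x x) (≤-by-∨≡1 x∨x*≡1 ≤-refl (≤-trans (x⊙x*≤0 x) (0-least (x ⊙ x))))

  pow-+ : ∀ x m n → pow L x (m + n) ≡ pow L x m ⊙ pow L x n
  pow-+ x zero n = sym (⊙-identityˡ _)
  pow-+ x (sucℕ m) n = trans (cong (x ⊙_) (pow-+ x m n)) (sym (⊙-assoc x _ _))

  ⊙-idem⇒pow-suc≡ : ∀ {x} → x ⊙ x ≡ x → ∀ n → pow L x (sucℕ n) ≡ x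
  ⊙-idem⇒pow-suc≡ {x} _ zero = ⊙-identityʳ x
  ⊙-idem⇒pow-suc≡ {x} x⊙x≡x (sucℕ n) = trans (cong (x ⊙_) (⊙-idem⇒pow-suc≡ x⊙x≡x n)) x⊙x≡x

  module Filter {F : Pred Carrier ℓ} (isFilter : IsFilter L F) where
    open IsFilter isFilter

    1∈F : F 1#
    1∈F = up-closed (proj₂ nonempty) (1-greatest _)

    pow∈F : ∀ {x} n → F x → F (pow L x n)
    pow∈F zero _ = 1∈F
    pow∈F (sucℕ n) Fx = ⊙-closed Fx (pow∈F n Fx)

    0∈F⇒all : F 0# → ∀ y → F y
    0∈F⇒all F0 y = up-closed F0 (0-least y)

    gen⊆F : ∀ {x} → F x → gen L x ⊆ F
    gen⊆F Fx (n , xⁿ⁺¹≤y) = up-closed (pow∈F (sucℕ n) Fx) xⁿ⁺¹≤y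

  ≤⇒gen : ∀ {x y} → x ≤ y → gen L x y
  ≤⇒gen {x} x≤y = zero , ≤-trans (≤-reflexive (⊙-identityʳ x)) x≤y

  gen-isFilter : ∀ x → IsFilter L (gen L x)
  gen-isFilter x = record
    { nonempty = 1# , ≤⇒gen (1-greatest x)
    ; ⊙-closed = λ { {y} {z} (m , xᵐ⁺¹≤y) (n , xⁿ⁺¹≤z) →
        m + sucℕ n , subst (_≤ y ⊙ z) (sym (pow-+ x (sucℕ m) (sucℕ n))) (⊙-mono xᵐ⁺¹≤y xⁿ⁺¹≤z) }
    ; up-closed = λ { (n , xⁿ⁺¹≤y) y≤z → n , ≤-trans xⁿ⁺¹≤y y≤z }
    }

  ∩-isFilter : ∀ {F G} → IsFilter L F → IsFilter L G → IsFilter L (F ∩ G)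
  ∩-isFilter isF isG = record
    { nonempty = 1# , Filter.1∈F isF , Filter.1∈F isG
    ; ⊙-closed = λ (Fx , Gx) (Fy , Gy) → F.⊙-closed Fx Fy , G.⊙-closed Gx Gy
    ; up-closed = λ (Fx , Gx) x≤y → F.up-closed Fx x≤y , G.up-closed Gx x≤y
    }
    where
    module F = IsFilter isF
    module G = IsFilter isG

  ⟨_∪_⟩ : Pred Carrier ℓ → Pred Carrier ℓ → Pred Carrier ℓ
  ⟨ F ∪ G ⟩ z = ∃₂ λ x y → F x × G y × x ⊙ y ≤ z

  ⟨∪⟩-isFilter : ∀ {F G} → IsFilter L F → IsFilter L G → IsFilter L ⟨ F ∪ G ⟩
  ⟨∪⟩-isFilter isF isG = record
    { nonempty = 1# , 1# , 1# , Filter.1∈F isF , Filter.1∈F isG , x⊙y≤x 1# 1#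
    ; ⊙-closed = λ { {z} {z′} (x , y , Fx , Gy , xy≤z) (x′ , y′ , Fx′ , Gy′ , x′y′≤z′) →
        x ⊙ x′ , y ⊙ y′ , F.⊙-closed Fx Fx′ , G.⊙-closed Gy Gy′ ,
        subst (_≤ z ⊙ z′) (⊙-interchange x y x′ y′) (⊙-mono xy≤z x′y′≤z′) }
    ; up-closed = λ { (x , y , Fx , Gy , xy≤z) z≤w → x , y , Fx , Gy , ≤-trans xy≤z z≤w }
    }
    where
    module F = IsFilter isF
    module G = IsFilter isG

  ⊆⟨∪⟩ˡ : ∀ {F G} → IsFilter L G → F ⊆ ⟨ F ∪ G ⟩
  ⊆⟨∪⟩ˡ isG {x} Fx = x , 1# , Fx , Filter.1∈F isG , ≤-reflexive (⊙-identityʳ x)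

  ⊆⟨∪⟩ʳ : ∀ {F G} → IsFilter L F → G ⊆ ⟨ F ∪ G ⟩
  ⊆⟨∪⟩ʳ isF {y} Gy = 1# , y , Filter.1∈F isF , Gy , ≤-reflexive (⊙-identityˡ y)

  ∉maximal⇒∃pow*∈ : ExcludedMiddle (suc ℓ) → ∀ {M x} → IsMaximal L M → ¬ M x →
              ∃ λ n → M (pow L x (sucℕ n) ⇒ 0#)
  ∉maximal⇒∃pow*∈ em {M} {x} (isM , _ , maximal) x∉M with decide em (⟨ M ∪ gen L x ⟩ 0#)
  ... | yes (m , y , Mm , (n , xⁿ⁺¹≤y) , my≤0) =
    n , IsFilter.up-closed isM Mm
          (residuation→ _ 0# m (≤-trans (⊙-monoˡ m xⁿ⁺¹≤y) (subst (_≤ 0#) (⊙-comm m y) my≤0)))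
  ... | no 0∉J = ⊥-elim (x∉M (maximal ⟨ M ∪ gen L x ⟩ (⟨∪⟩-isFilter isM (gen-isFilter x))
                   (λ J≐U → 0∉J (J≐U 0#)) (⊆⟨∪⟩ˡ (gen-isFilter x)) (⊆⟨∪⟩ʳ isM (≤⇒gen ≤-refl))))

  simple-∩-dichotomy : ∀ {T G} → IsSimple L T → IsFilter L G →
                       (∀ {y} → T y → G y → y ≡ 1#) ⊎ T ⊆ G
  simple-∩-dichotomy {T} {G} (isT , _ , minimal) isG
    with minimal (T ∩ G) (∩-isFilter isT isG) proj₁
  ... | inj₁ (T∩G⊆1 , _) = inj₁ (λ Ty Gy → sym (T∩G⊆1 (Ty , Gy)))
  ... | inj₂ (_ , T⊆T∩G) = inj₂ (proj₂ ∘ T⊆T∩G)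

  simple-∨≡1 : ∀ {T G x y} → IsSimple L T → IsFilter L G → T x → ¬ G x → G y → x ∨ y ≡ 1#
  simple-∨≡1 {x = x} {y} simple@(isT , _) isG Tx x∉G Gy with simple-∩-dichotomy simple isG
  ... | inj₁ T∩G⊆1 = T∩G⊆1 (IsFilter.up-closed isT Tx (x≤x∨y x y))
                           (IsFilter.up-closed isG Gy (y≤x∨y x y))
  ... | inj₂ T⊆G = ⊥-elim (x∉G (T⊆G Tx))

  module ComplementedGenerator (em : ExcludedMiddle (suc ℓ)) {T} (simple : IsSimple L T)
                               {x} (Tx : T x) ([x*⟩-proper : ¬ gen L (x ⇒ 0#) 0#) where

    x∉[x*⟩ : ¬ gen L (x ⇒ 0#) x
    x∉[x*⟩ (n , x*ⁿ⁺¹≤x) = [x*⟩-proper (sucℕ n , ≤-trans (⊙-monoʳ (x ⇒ 0#) x*ⁿ⁺¹≤x) (x*⊙x≤0 x))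

    T⊈[x*⟩ : ¬ T ⊆ gen L (x ⇒ 0#)
    T⊈[x*⟩ T⊆[x*⟩ = x∉[x*⟩ (T⊆[x*⟩ Tx)

    x∨x*≡1 : x ∨ (x ⇒ 0#) ≡ 1#
    x∨x*≡1 = simple-∨≡1 simple (gen-isFilter (x ⇒ 0#)) Tx x∉[x*⟩ (≤⇒gen ≤-refl)

    T≐[x⟩ : T ≐ gen L x
    T≐[x⟩ with simple-∩-dichotomy simple (gen-isFilter x)
    ... | inj₁ T∩[x⟩⊆1 = ⊥-elim ([x*⟩-proper (≤⇒gen x*≤0))
      where
      x*≤0 : x ⇒ 0# ≤ 0#
      x*≤0 = subst (λ u → u ⇒ 0# ≤ 0#) (sym (T∩[x⟩⊆1 Tx (≤⇒gen ≤-refl))) 1*≤0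
    ... | inj₂ T⊆[x⟩ = T⊆[x⟩ , Filter.gen⊆F (proj₁ simple) Tx

    proper⊇[x*⟩⇒⊆[x*⟩ : ∀ G → IsFilter L G → Proper L G → gen L (x ⇒ 0#) ⊆ G → G ⊆ gen L (x ⇒ 0#)
    proper⊇[x*⟩⇒⊆[x*⟩ G isG properG [x*⟩⊆G Gy = ≤⇒gen (∨≡1⇒*≤ (simple-∨≡1 simple isG Tx x∉G Gy))
      where
      open IsFilter isG
      x∉G : ¬ G x
      x∉G Gx = properG (Filter.0∈F⇒all isG
        (up-closed (⊙-closed Gx ([x*⟩⊆G (≤⇒gen ≤-refl))) (x⊙x*≤0 x)))

    [x*⟩-isMaximal : IsMaximal L (gen L (x ⇒ 0#))
    [x*⟩-isMaximal =
      gen-isFilter (x ⇒ 0#) , (λ [x*⟩≐U → [x*⟩-proper ([x*⟩≐U 0#)) , proper⊇[x*⟩⇒⊆[x*⟩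

    maximal⊉T⇒≐[x*⟩ : ∀ M → IsMaximal L M → ¬ T ⊆ M → M ≐ gen L (x ⇒ 0#)
    maximal⊉T⇒≐[x*⟩ M isMax@(isM , properM , _) T⊈M =
      proper⊇[x*⟩⇒⊆[x*⟩ M isM properM [x*⟩⊆M , [x*⟩⊆M
      where
      x∉M : ¬ M x
      x∉M Mx = T⊈M (Filter.gen⊆F isM Mx ∘ proj₁ T≐[x⟩)
      Mx* : M (x ⇒ 0#)
      Mx* with ∉maximal⇒∃pow*∈ em isMax x∉M
      ... | n , Mxⁿ⁺¹* = subst (λ u → M (u ⇒ 0#)) (⊙-idem⇒pow-suc≡ (∨*≡1⇒⊙-idem x∨x*≡1) n) Mxⁿ⁺¹*
      [x*⟩⊆M : gen L (x ⇒ 0#) ⊆ M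
      [x*⟩⊆M = Filter.gen⊆F isM Mx*

  gen*∋0⇒⊆Rad : ExcludedMiddle (suc ℓ) → ∀ {T} → IsFilter L T →
                (∀ x → T x → gen L (x ⇒ 0#) 0#) → T ⊆ Rad L
  gen*∋0⇒⊆Rad em isT [x*⟩∋0 {x} Tx M isMax@(isM , properM , _) with decide em (M x)
  ... | yes Mx = Mx
  ... | no x∉M with ∉maximal⇒∃pow*∈ em isMax x∉M
  ... | n , Mxⁿ⁺¹* = ⊥-elim (properM (Filter.0∈F⇒all isM
          (Filter.gen⊆F isM Mxⁿ⁺¹* ([x*⟩∋0 _ (Filter.pow∈F isT (sucℕ n) Tx)))))

open ResiduatedLattice using (0#)

proposition2p5 : ∀ {ℓ : Level} (L : ResiduatedLattice ℓ) → ExcludedMiddle (suc ℓ)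
    → (T : Pred (ResiduatedLattice.Carrier L) ℓ) → IsSimple L T
    → (Σ (ResiduatedLattice.Carrier L) (λ x → B L x × (T ≐ gen L x)
          × IsMaximal L (gen L (_* L x)) × ¬ (T ⊆ gen L (_* L x))
          × (∀ (M : Pred (ResiduatedLattice.Carrier L) ℓ) → IsMaximal L M → ¬ (T ⊆ M)
               → M ≐ gen L (_* L x))))
      ⊎ ((∀ x → T x → gen L (_* L x) ≐ U) × (T ⊆ Rad L))
proposition2p5 L em T simple with decide em (∃ λ x → T x × ¬ gen L (_* L x) (0# L))
... | yes (x , Tx , [x*⟩-proper) =
  inj₁ (x , (_* L x , x∨x*≡1 , ∨*≡1⇒∧*≡0 L x∨x*≡1) , T≐[x⟩
          , [x*⟩-isMaximal , T⊈[x*⟩ , maximal⊉T⇒≐[x*⟩)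
  where open ComplementedGenerator L em simple Tx [x*⟩-proper
... | no ∄ =
  inj₂ ((λ x Tx → (λ _ → tt) , λ _ → [x*⟩-full x Tx _) , gen*∋0⇒⊆Rad L em (proj₁ simple) 0∈[x*⟩)
  where
  0∈[x*⟩ : ∀ x → T x → gen L (_* L x) (0# L)
  0∈[x*⟩ x Tx = decidable-stable (decide em _) (λ 0∉[x*⟩ → ∄ (x , Tx , 0∉[x*⟩))
  [x*⟩-full : ∀ x → T x → ∀ y → gen L (_* L x) y
  [x*⟩-full x Tx = Filter.0∈F⇒all L (gen-isFilter L _) (0∈[x*⟩ x Tx)
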